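{- There is an algorithm which, given a Sudoku rule $\mathcal{S}$ and an initial condition $\mathcal{C}$, generates in finite time a finite Abelian group $H_1$ and a weakly expressible $(\mathbb{Z}^2\times\mathbb{Z}/2\mathbb{Z},H_1)$-property $P$, together with a system of functional equations witnessing the weak expressibility of $P$, such that the $(\mathcal{S},\mathcal{C})$-Sudoku puzzle is solvable if and only if $P$ is satisfiable.
   Context: Sudoku puzzles: for a natural number $N$ and non-empty finite set $\Sigma$, $\mathbb{B}=\{0,\dots,N-1\}\times\mathbb{Z}$; a Sudoku rule is a set $\mathcal{S}$ of functions $\{0,\dots,N-1\}\to\Sigma$; an $\mathcal{S}$-Sudoku solution is $F:\mathbb{B}\to\Sigma$ with $n\mapsto F(n,jn+i)$ in $\mathcal{S}$ for all $j,i\in\mathbb{Z}$; an initial condition with period $q\ge1$ is $\mathcal{C}\subset(\mathbb{Z}/q\mathbb{Z})\times\Sigma$, and $F$ obeys it if for each $n$ there is a permutation $\sigma_n$ of $\mathbb{Z}/q\mathbb{Z}$ with $(\sigma_n(m\bmod q),F(n,m))\in\mathcal{C}$ for all $m$; the puzzle is solvable if some solution obeys $\mathcal{C}$. Expressibility: for $G$ finitely generated Abelian and $H$ finite Abelian, a $(G,H)$-property is a set $P$ of functions $\alpha:G\to H$, satisfiable if nonempty. It is expressible if there exist $M\in\mathbb{N}$, and for $i=1,\dots,M$ numbers $J_i$, sets $E'_i\subset H$, shifts $h_{i,j}\in G$ and sets $E_{i,j}\subset H$ ($j\le J_i$), such that $\alpha\in P$ iff for all $i$ and $x\in G$ the sets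 $\alpha(x+h_{i,j})+E_{i,j}$ ($j=1,\dots,J_i$) are pairwise disjoint with union $E'_i$. For tuples $(\alpha_u:G\to H_u)_{u\in\mathcal{U}}$ properties are identified with $(G,\prod_uH_u)$-properties. A property $P$ of tuples indexed by $\mathcal{U}$ is weakly expressible if there is an expressible property $P^*$ of tuples indexed by $\mathcal{U}\uplus\mathcal{U}^*$ (with finite Abelian targets) such that a tuple obeys $P$ iff it has an extension obeying $P^*$; the witnessing system is that of $P^*$. -}

module Defs where

open import Data.Nat as ℕ using (ℕ; zero; suc)
open import Data.Nat.DivMod using (_mod_)
open import Data.Integer as ℤ using (ℤ; +_)
open import Data.Integer.DivMod using (_%ℕ_; n%ℕd<d)
open import Data.Fin using (Fin; toℕ; fromℕ<)
open import Data.Fin.Permutation using (Permutation′; _⟨$⟩ʳ_)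
open import Data.Vec using (Vec; tabulate)
open import Data.List using (List; []; _∷_; _++_)
open import Data.List.Relation.Unary.All using (All)
open import Data.Bool using (Bool; true)
open import Data.Unit using (⊤; tt)
open import Data.Empty using (⊥)
open import Data.Product using (Σ; ∃; _×_; _,_)
open import Relation.Binary.PropositionalEquality using (_≡_; _≢_)

-- Σ = Fin (suc k) (a non-empty finite set); period q = suc q′ ≥ 1.
-- The rule 𝒮 ⊂ (Fin N → Σ) is given by its (decidable) indicator on
-- tabulated functions; 𝒞 ⊂ ℤ/qℤ × Σ by its indicator, ℤ/qℤ = Fin q.
record SudokuInstance : Set where
  field
    N    : ℕ
    k    : ℕ
    rule : Vec (Fin (suc k)) N → Bool
    q′   : ℕ
    cond : Fin (suc q′) → Fin (suc k) → Bool

reduce : (q′ : ℕ) → ℤ → Fin (suc q′)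
reduce q′ m = fromℕ< (n%ℕd<d m (suc q′))

module _ (I : SudokuInstance) where
  open SudokuInstance I

  IsSudokuSolution : (Fin N → ℤ → Fin (suc k)) → Set
  IsSudokuSolution F =
    ∀ (j i : ℤ) → rule (tabulate (λ n → F n (j ℤ.* + toℕ n ℤ.+ i))) ≡ true

  Obeys : (Fin N → ℤ → Fin (suc k)) → Set
  Obeys F = ∀ (n : Fin N) → ∃ λ (σ : Permutation′ (suc q′)) →
              ∀ (m : ℤ) → cond (σ ⟨$⟩ʳ reduce q′ m) (F n m) ≡ true

  Solvable : Set
  Solvable = ∃ λ (F : Fin N → ℤ → Fin (suc k)) → IsSudokuSolution F × Obeys F

-- Finite Abelian groups ℤ/(m₁+1) × ... × ℤ/(m_r+1), given by [m₁,…,m_r]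

Elem : List ℕ → Set
Elem []       = ⊤
Elem (m ∷ ms) = Fin (suc m) × Elem ms

addFin : ∀ {m} → Fin (suc m) → Fin (suc m) → Fin (suc m)
addFin {m} a b = (toℕ a ℕ.+ toℕ b) mod suc m

_⊕_ : ∀ {ms} → Elem ms → Elem ms → Elem ms
_⊕_ {[]}     _        _        = tt
_⊕_ {m ∷ ms} (a , as) (b , bs) = addFin a b , as ⊕ bs

join : ∀ {as bs} → Elem as → Elem bs → Elem (as ++ bs)
join {[]}     _        y = y
join {a ∷ as} (x , xs) y = x , join xs y

G : Set
G = ℤ × ℤ × Fin 2

_+G_ : G → G → G
(a , b , c) +G (a′ , b′ , c′) = a ℤ.+ a′ , b ℤ.+ b′ , addFin c c′

Subset : List ℕ → Set
Subset H = Elem H → Bool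

_∈_+_ : ∀ {H} → Elem H → Elem H → Subset H → Set
e ∈ a + E = ∃ λ e₀ → E e₀ ≡ true × e ≡ a ⊕ e₀

-- One functional equation: the sets α(x+h_j)+E_j (j < J) are pairwise
-- disjoint with union E′.
record Equation (H : List ℕ) : Set where
  field
    J     : ℕ
    E′    : Subset H
    shift : Fin J → G
    E     : Fin J → Subset H

Holds : ∀ {H} → Equation H → (G → Elem H) → G → Set
Holds eq α x =
  (∀ (j j′ : Fin J) → j ≢ j′ → ∀ e →
      e ∈ α (x +G shift j) + E j → e ∈ α (x +G shift j′) + E j′ → ⊥)
  × (∀ e → (E′ e ≡ true → ∃ λ j → e ∈ α (x +G shift j) + E j)
         × (∃ (λ j → e ∈ α (x +G shift j) + E j) → E′ e ≡ true))
  where open Equation eq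

System : List ℕ → Set
System H = List (Equation H)

SatisfiesSystem : ∀ {H} → System H → (G → Elem H) → Set
SatisfiesSystem sys α = All (λ eq → ∀ x → Holds eq α x) sys

-- A system witnessing weak expressibility of a (G,H₁)-property:
-- an expressible property of tuples (α, β) with α : G → H₁ and auxiliary
-- β : G → H₂ (the components indexed by 𝒰*).
record WeakSystem : Set where
  field
    H₁  : List ℕ
    H₂  : List ℕ
    sys : System (H₁ ++ H₂)

module _ (W : WeakSystem) where
  open WeakSystem W

  P : (G → Elem H₁) → Set
  P α = ∃ λ (β : G → Elem H₂) → SatisfiesSystem sys (λ x → join (α x) (β x))

  Satisfiable : Set
  Satisfiable = ∃ λ (α : G → Elem H₁) → P α

{-# OPTIONS --safe #-}
-- A point (j, i, c) of G = ℤ² × ℤ/2ℤ stands for the line of slope j through (0, i), and the unknown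
-- β : G → (ℤ/M)^(1 + #patterns) stores there, as a one-hot table, which allowed pattern
-- (σₙ(jn + i mod q), F(n, jn + i))ₙ a solution shows along that line. When all sets of a functional
-- equation are preimages under a homomorphism φ to ℤ/M, the equation becomes a constraint on the values
-- of φ ∘ β: invariance under a shift, a prescribed value, or distinct values below J at J shifted points.
-- Pinning each coordinate at x and x + (0, 0, 1) to {0, 1} makes the table a bit vector (complemented on
-- the second layer), and a linear form counting the bits makes it one-hot. Linear forms reading a symbol
-- or a permuted residue of the selected pattern then turn invariance along (1, −n) into a single F seen
-- by all lines, and q-periodicity plus distinctness on windows of length q into the permutations σₙ.
module Submission where

open import Defs
open import Data.Product using (Σ)
open import Function.Bundles using (_⇔_)

open import Algebra.Morphism.Definitions using (Homomorphic₂)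
open import Data.Bool as Bool using (Bool; true; false; not)
open import Data.Empty using (⊥; ⊥-elim)
open import Data.Fin as F using (Fin; zero; suc; toℕ; fromℕ<; opposite)
import Data.Fin.Properties as FP
open import Data.Fin.Permutation as Perm using (Permutation′; _⟨$⟩ʳ_; _⟨$⟩ˡ_; inverseˡ; inverseʳ)
open import Data.Integer as ℤ using (ℤ; +_; -[1+_])
open import Data.Integer.DivMod using (n%ℕd<d; a≡a%ℕn+[a/ℕn]*n)
import Data.Integer.Properties as ℤP
import Data.Integer.Solver as ℤSolver
open import Data.List as L using (List; []; _∷_; _++_; length)
open import Data.List.Membership.Propositional using () renaming (_∈_ to _∈ₗ_)
open import Data.List.Membership.Propositional.Properties
  using (∈-cartesianProductWith⁺; ∈-cartesianProduct⁺; ∈-allFin; ∈-lookup; ∈-filter⁺; ∈-filter⁻)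
open import Data.List.Relation.Unary.All using (_∷_)
import Data.List.Relation.Unary.All.Properties as AllP
open import Data.List.Relation.Unary.Any as Any using (here)
open import Data.List.Relation.Unary.Any.Properties using (lookup-index)
open import Data.Nat as ℕ using (ℕ; _≤_; _<_; z≤n; s≤s; _%_)
open import Data.Nat.DivMod
  using (_mod_; _/_; m≡m%n+[m/n]*n; m%n<n; n%n≡0; m%n%n≡m%n; [m+n]%n≡m%n; [m+kn]%n≡m%n; m<n⇒m%n≡m;
         %-distribˡ-+; %-distribˡ-*)
import Data.Nat.Properties as ℕP
import Data.Nat.Solver as ℕSolver
open import Data.Product using (∃; _×_; _,_; proj₁; proj₂)
open import Data.Sum using (_⊎_; inj₁; inj₂)
open import Data.Unit using (tt)
open import Data.Vec as V using (Vec)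
import Data.Vec.Properties as VP
open import Data.Vec.Relation.Unary.All as VAll using () renaming (All to VAll)
import Data.Vec.Relation.Unary.All.Properties as VAllP
open import Function.Base using (_∘_; const)
open import Function.Bundles using (mk⇔; Equivalence)
open import Function.Properties.Equivalence using () renaming (trans to ⇔-trans)
open import Level using (0ℓ)
open import Relation.Binary.PropositionalEquality
open import Relation.Nullary using (Dec; yes; no; does; _×-dec_)
open import Relation.Unary using (Pred; Decidable)

-- Arithmetic modulo M in Fin M

module _ {m : ℕ} where

  private
    M : ℕ
    M = ℕ.suc m

  subFin : Fin M → Fin M → Fin M
  subFin a b = (toℕ a ℕ.+ (M ℕ.∸ toℕ b)) mod M

  toℕ-mod : ∀ n → toℕ (n mod M) ≡ n % M
  toℕ-mod n = FP.toℕ-fromℕ< _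

  toℕ-mod-toℕ : ∀ (a : Fin M) → toℕ a mod M ≡ a
  toℕ-mod-toℕ a = FP.toℕ-injective (trans (toℕ-mod (toℕ a)) (m<n⇒m%n≡m (FP.toℕ<n a)))

  mod-cong : ∀ x y → x % M ≡ y % M → x mod M ≡ y mod M
  mod-cong x y eq = FP.toℕ-injective (trans (toℕ-mod x) (trans eq (sym (toℕ-mod y))))

  %-absorbʳ : ∀ x y → (x ℕ.+ y % M) % M ≡ (x ℕ.+ y) % M
  %-absorbʳ x y = begin
    (x ℕ.+ y % M) % M          ≡⟨ %-distribˡ-+ x (y % M) M ⟩
    (x % M ℕ.+ y % M % M) % M  ≡⟨ cong (λ z → (x % M ℕ.+ z) % M) (m%n%n≡m%n y M) ⟩
    (x % M ℕ.+ y % M) % M      ≡⟨ %-distribˡ-+ x y M ⟨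
    (x ℕ.+ y) % M              ∎
    where open ≡-Reasoning

  %-absorbˡ : ∀ x y → (x % M ℕ.+ y) % M ≡ (x ℕ.+ y) % M
  %-absorbˡ x y = begin
    (x % M ℕ.+ y) % M  ≡⟨ cong (_% M) (ℕP.+-comm (x % M) y) ⟩
    (y ℕ.+ x % M) % M  ≡⟨ %-absorbʳ y x ⟩
    (y ℕ.+ x) % M      ≡⟨ cong (_% M) (ℕP.+-comm y x) ⟩
    (x ℕ.+ y) % M      ∎
    where open ≡-Reasoning

  +-complement : ∀ (a : Fin M) x → toℕ a ℕ.+ x ℕ.+ (M ℕ.∸ toℕ a) ≡ x ℕ.+ M
  +-complement a x = begin
    toℕ a ℕ.+ x ℕ.+ (M ℕ.∸ toℕ a)    ≡⟨ cong (ℕ._+ (M ℕ.∸ toℕ a)) (ℕP.+-comm (toℕ a) x) ⟩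
    x ℕ.+ toℕ a ℕ.+ (M ℕ.∸ toℕ a)    ≡⟨ ℕP.+-assoc x (toℕ a) _ ⟩
    x ℕ.+ (toℕ a ℕ.+ (M ℕ.∸ toℕ a))  ≡⟨ cong (x ℕ.+_) (ℕP.m+[n∸m]≡n (ℕP.<⇒≤ (FP.toℕ<n a))) ⟩
    x ℕ.+ M                          ∎
    where open ≡-Reasoning

  %-cong-+ : ∀ a a′ b b′ → a % M ≡ a′ % M → b % M ≡ b′ % M → (a ℕ.+ b) % M ≡ (a′ ℕ.+ b′) % M
  %-cong-+ a a′ b b′ a≡ b≡ = begin
    (a ℕ.+ b) % M              ≡⟨ %-distribˡ-+ a b M ⟩
    (a % M ℕ.+ b % M) % M      ≡⟨ cong₂ (λ u v → (u ℕ.+ v) % M) a≡ b≡ ⟩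
    (a′ % M ℕ.+ b′ % M) % M    ≡⟨ %-distribˡ-+ a′ b′ M ⟨
    (a′ ℕ.+ b′) % M            ∎
    where open ≡-Reasoning

  %-cong-*ˡ : ∀ c b b′ → b % M ≡ b′ % M → (c ℕ.* b) % M ≡ (c ℕ.* b′) % M
  %-cong-*ˡ c b b′ b≡ = begin
    (c ℕ.* b) % M              ≡⟨ %-distribˡ-* c b M ⟩
    (c % M ℕ.* (b % M)) % M    ≡⟨ cong (λ u → (c % M ℕ.* u) % M) b≡ ⟩
    (c % M ℕ.* (b′ % M)) % M   ≡⟨ %-distribˡ-* c b′ M ⟨
    (c ℕ.* b′) % M             ∎
    where open ≡-Reasoning

  toℕ-addFin-% : ∀ a b → toℕ (addFin a b) % M ≡ (toℕ a ℕ.+ toℕ b) % M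
  toℕ-addFin-% a b = trans (cong (_% M) (toℕ-mod (toℕ a ℕ.+ toℕ b))) (m%n%n≡m%n (toℕ a ℕ.+ toℕ b) M)

  addFin-subFin : ∀ a e → addFin a (subFin e a) ≡ e
  addFin-subFin a e = trans (mod-cong (toℕ a ℕ.+ toℕ (subFin e a)) (toℕ e) (begin
    (toℕ a ℕ.+ toℕ (subFin e a)) % M              ≡⟨ cong (λ z → (toℕ a ℕ.+ z) % M) (toℕ-mod (toℕ e ℕ.+ (M ℕ.∸ toℕ a))) ⟩
    (toℕ a ℕ.+ (toℕ e ℕ.+ (M ℕ.∸ toℕ a)) % M) % M  ≡⟨ %-absorbʳ (toℕ a) _ ⟩
    (toℕ a ℕ.+ (toℕ e ℕ.+ (M ℕ.∸ toℕ a))) % M      ≡⟨ cong (_% M) (sym (ℕP.+-assoc (toℕ a) (toℕ e) _)) ⟩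
    (toℕ a ℕ.+ toℕ e ℕ.+ (M ℕ.∸ toℕ a)) % M        ≡⟨ cong (_% M) (+-complement a (toℕ e)) ⟩
    (toℕ e ℕ.+ M) % M                              ≡⟨ [m+n]%n≡m%n (toℕ e) M ⟩
    toℕ e % M                                      ∎)) (toℕ-mod-toℕ e)
    where open ≡-Reasoning

  subFin-addFin : ∀ a b → subFin (addFin a b) a ≡ b
  subFin-addFin a b = trans (mod-cong (toℕ (addFin a b) ℕ.+ (M ℕ.∸ toℕ a)) (toℕ b) (begin
    (toℕ (addFin a b) ℕ.+ (M ℕ.∸ toℕ a)) % M     ≡⟨ cong (λ z → (z ℕ.+ (M ℕ.∸ toℕ a)) % M) (toℕ-mod (toℕ a ℕ.+ toℕ b)) ⟩
    ((toℕ a ℕ.+ toℕ b) % M ℕ.+ (M ℕ.∸ toℕ a)) % M ≡⟨ %-absorbˡ (toℕ a ℕ.+ toℕ b) _ ⟩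
    (toℕ a ℕ.+ toℕ b ℕ.+ (M ℕ.∸ toℕ a)) % M       ≡⟨ cong (_% M) (+-complement a (toℕ b)) ⟩
    (toℕ b ℕ.+ M) % M                             ≡⟨ [m+n]%n≡m%n (toℕ b) M ⟩
    toℕ b % M                                     ∎)) (toℕ-mod-toℕ b)
    where open ≡-Reasoning

  addFin-identityʳ : ∀ a → addFin a zero ≡ a
  addFin-identityʳ a = trans (cong (_mod M) (ℕP.+-identityʳ (toℕ a))) (toℕ-mod-toℕ a)

  subFin≡zero⇔ : ∀ {y v} → subFin y v ≡ zero ⇔ y ≡ v
  subFin≡zero⇔ {y} {v} = mk⇔
    (λ eq → trans (sym (addFin-subFin v y)) (trans (cong (addFin v) eq) (addFin-identityʳ v)))
    (λ { refl → trans (cong (λ z → subFin z y) (sym (addFin-identityʳ y))) (subFin-addFin y zero) })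

  rotation : Fin M → Permutation′ M
  rotation a = Perm.permutation (addFin a) (λ e → subFin e a) (addFin-subFin a) (subFin-addFin a)

_⊖_ : ∀ {H} → Elem H → Elem H → Elem H
_⊖_ {[]}    _        _        = tt
_⊖_ {_ ∷ _} (e , es) (a , as) = subFin e a , es ⊖ as

⊕-⊖ : ∀ {H} (a e : Elem H) → a ⊕ (e ⊖ a) ≡ e
⊕-⊖ {[]}    _        _        = refl
⊕-⊖ {_ ∷ _} (a , as) (e , es) = cong₂ _,_ (addFin-subFin a e) (⊕-⊖ as es)

-- Invariant functions on G = ℤ² × ℤ/2ℤ

0G : G
0G = + 0 , + 0 , zero

step : ℤ → ℤ → G
step a b = a , b , zero

flipLayer : G
flipLayer = + 0 , + 0 , suc zero

+G-step : ∀ a b c a′ b′ → (a , b , c) +G step a′ b′ ≡ (a ℤ.+ a′ , b ℤ.+ b′ , c)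
+G-step a b c a′ b′ = cong (λ c′ → a ℤ.+ a′ , b ℤ.+ b′ , c′) (addFin-identityʳ c)

+G-identityʳ : ∀ x → x +G 0G ≡ x
+G-identityʳ (a , b , c) =
  trans (+G-step a b c (+ 0) (+ 0)) (cong₂ (λ a′ b′ → a′ , b′ , c) (ℤP.+-identityʳ a) (ℤP.+-identityʳ b))

+G-flipLayer : ∀ a b c → (a , b , c) +G flipLayer ≡ (a , b , opposite c)
+G-flipLayer a b zero    = cong₂ (λ a′ b′ → a′ , b′ , suc zero) (ℤP.+-identityʳ a) (ℤP.+-identityʳ b)
+G-flipLayer a b (suc zero) = cong₂ (λ a′ b′ → a′ , b′ , zero) (ℤP.+-identityʳ a) (ℤP.+-identityʳ b)

step-invariant⇒constant : ∀ {A : Set} (g : ℤ → A) → (∀ z → g (z ℤ.+ ℤ.1ℤ) ≡ g z) → ∀ z → g z ≡ g ℤ.0ℤ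
step-invariant⇒constant g invariant = λ
  { (+ n)    → shift n ℤ.0ℤ
  ; -[1+ n ] → sym (trans (cong g (sym (ℤP.+-inverseˡ (+ ℕ.suc n)))) (shift (ℕ.suc n) -[1+ n ]))
  }
  where
  shift : ∀ n z → g (z ℤ.+ + n) ≡ g z
  shift ℕ.zero    z = cong g (ℤP.+-identityʳ z)
  shift (ℕ.suc n) z = begin
    g (z ℤ.+ + ℕ.suc n)        ≡⟨ cong (λ k → g (z ℤ.+ + k)) (ℕP.+-comm 1 n) ⟩
    g (z ℤ.+ (+ n ℤ.+ ℤ.1ℤ))   ≡⟨ cong g (ℤP.+-assoc z (+ n) ℤ.1ℤ) ⟨
    g (z ℤ.+ + n ℤ.+ ℤ.1ℤ)     ≡⟨ invariant (z ℤ.+ + n) ⟩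
    g (z ℤ.+ + n)              ≡⟨ shift n z ⟩
    g z                        ∎
    where open ≡-Reasoning

module _ {A : Set} (f : G → A) {a b : ℤ} (invariant : ∀ x → f (x +G step a b) ≡ f x) where
  open ℤSolver.+-*-Solver

  invariant-multiples : ∀ z x₁ x₂ c → f (x₁ ℤ.+ z ℤ.* a , x₂ ℤ.+ z ℤ.* b , c) ≡ f (x₁ , x₂ , c)
  invariant-multiples z x₁ x₂ c =
    trans (step-invariant⇒constant g g-step z) (cong₂ (λ u v → f (u , v , c)) (+0* x₁ a) (+0* x₂ b))
    where
    g : ℤ → A
    g z = f (x₁ ℤ.+ z ℤ.* a , x₂ ℤ.+ z ℤ.* b , c)
    +suc* : ∀ x z a → x ℤ.+ (z ℤ.+ ℤ.1ℤ) ℤ.* a ≡ (x ℤ.+ z ℤ.* a) ℤ.+ a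
    +suc* = solve 3 (λ x z a → x :+ (z :+ con ℤ.1ℤ) :* a := (x :+ z :* a) :+ a) refl
    +0* : ∀ x a → x ℤ.+ ℤ.0ℤ ℤ.* a ≡ x
    +0* = solve 2 (λ x a → x :+ con ℤ.0ℤ :* a := x) refl
    g-step : ∀ z → g (z ℤ.+ ℤ.1ℤ) ≡ g z
    g-step z = trans (cong₂ (λ u v → f (u , v , c)) (+suc* x₁ z a) (+suc* x₂ z b))
                 (trans (cong f (sym (+G-step (x₁ ℤ.+ z ℤ.* a) (x₂ ℤ.+ z ℤ.* b) c a b))) (invariant _))

module _ {A : Set} (f : G → A) where
  open ℤSolver.+-*-Solver

  invariant-plane : (∀ x → f (x +G step ℤ.1ℤ ℤ.0ℤ) ≡ f x) → (∀ x → f (x +G step ℤ.0ℤ ℤ.1ℤ) ≡ f x) →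
                    ∀ j i c → f (j , i , c) ≡ f (+ 0 , + 0 , c)
  invariant-plane invariant₁ invariant₂ j i c = begin
    f (j , i , c)                                              ≡⟨ cong₂ (λ u v → f (u , v , c)) (unit j) (zero* i j) ⟨
    f (+ 0 ℤ.+ j ℤ.* ℤ.1ℤ , i ℤ.+ j ℤ.* ℤ.0ℤ , c)              ≡⟨ invariant-multiples f invariant₁ j (+ 0) i c ⟩
    f (+ 0 , i , c)                                            ≡⟨ cong₂ (λ u v → f (u , v , c)) (zero* (+ 0) i) (unit i) ⟨
    f (+ 0 ℤ.+ i ℤ.* ℤ.0ℤ , + 0 ℤ.+ i ℤ.* ℤ.1ℤ , c)            ≡⟨ invariant-multiples f invariant₂ i (+ 0) (+ 0) c ⟩
    f (+ 0 , + 0 , c)                                          ∎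
    where
    open ≡-Reasoning
    unit : ∀ z → + 0 ℤ.+ z ℤ.* ℤ.1ℤ ≡ z
    unit = solve 1 (λ z → con (+ 0) :+ z :* con ℤ.1ℤ := z) refl
    zero* : ∀ x z → x ℤ.+ z ℤ.* ℤ.0ℤ ≡ x
    zero* = solve 2 (λ x z → x :+ z :* con ℤ.0ℤ := x) refl

  invariant-diagonal : ∀ a → (∀ x → f (x +G step ℤ.1ℤ (ℤ.- a)) ≡ f x) →
                       ∀ j i c → f (j , i , c) ≡ f (+ 0 , j ℤ.* a ℤ.+ i , c)
  invariant-diagonal a invariant j i c =
    trans (cong₂ (λ u v → f (u , v , c)) (sym (unit j)) (sym (diagonal j a i)))
          (invariant-multiples f invariant j (+ 0) (j ℤ.* a ℤ.+ i) c)
    where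
    unit : ∀ z → + 0 ℤ.+ z ℤ.* ℤ.1ℤ ≡ z
    unit = solve 1 (λ z → con (+ 0) :+ z :* con ℤ.1ℤ := z) refl
    diagonal : ∀ j a i → (j ℤ.* a ℤ.+ i) ℤ.+ j ℤ.* ℤ.- a ≡ i
    diagonal = solve 3 (λ j a i → (j :* a :+ i) :+ j :* (:- a) := i) refl

  invariant-period : ∀ q .{{_ : ℕ.NonZero q}} → (∀ x → f (x +G step ℤ.0ℤ (+ q)) ≡ f x) →
                     ∀ m c → f (+ 0 , m , c) ≡ f (+ 0 , + (m ℤ.%ℕ q) , c)
  invariant-period q invariant m c =
    trans (cong₂ (λ u v → f (u , v , c)) (sym (zero* (+ 0) (m ℤ./ℕ q))) (a≡a%ℕn+[a/ℕn]*n m q))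
          (invariant-multiples f invariant (m ℤ./ℕ q) (+ 0) (+ (m ℤ.%ℕ q)) c)
    where
    zero* : ∀ x z → x ℤ.+ z ℤ.* ℤ.0ℤ ≡ x
    zero* = solve 2 (λ x z → x :+ z :* con ℤ.0ℤ := x) refl

-- Functional equations cut out by a homomorphism to a cyclic group

isZero : ∀ {n} → Fin n → Bool
isZero zero    = true
isZero (suc _) = false

isZero⇔ : ∀ {n} {y : Fin (ℕ.suc n)} → isZero y ≡ true ⇔ y ≡ zero
isZero⇔ {y = zero}  = mk⇔ (const refl) (const refl)
isZero⇔ {y = suc _} = mk⇔ (λ ()) (λ ())

notZero⇔ : ∀ {n} {y : Fin (ℕ.suc n)} → not (isZero y) ≡ true ⇔ y ≢ zero
notZero⇔ {y = zero}  = mk⇔ (λ ()) (λ y≢0 → ⊥-elim (y≢0 refl))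
notZero⇔ {y = suc _} = mk⇔ (λ _ ()) (const refl)

does⇔ : ∀ {A : Set} (a? : Dec A) → does a? ≡ true ⇔ A
does⇔ (yes a) = mk⇔ (const a) (const refl)
does⇔ (no ¬a) = mk⇔ (λ ()) (⊥-elim ∘ ¬a)

pinShifts : Fin 2 → G
pinShifts zero    = 0G
pinShifts (suc _) = flipLayer

+≡1⇒ : ∀ {a b} → a ℕ.+ b ≡ 1 → (a ≡ 0 × b ≡ 1) ⊎ (a ≡ 1 × b ≡ 0)
+≡1⇒ {ℕ.zero}  {ℕ.suc ℕ.zero} _ = inj₁ (refl , refl)
+≡1⇒ {ℕ.suc ℕ.zero} {ℕ.zero}  _ = inj₂ (refl , refl)
+≡1⇒ {ℕ.zero}  {ℕ.zero}  ()
+≡1⇒ {ℕ.zero}  {ℕ.suc (ℕ.suc _)} ()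
+≡1⇒ {ℕ.suc ℕ.zero} {ℕ.suc _} ()
+≡1⇒ {ℕ.suc (ℕ.suc _)} ()

distinct-bits : ∀ {a b} → a < 2 → b < 2 → a ≢ b → a ℕ.+ b ≡ 1
distinct-bits (s≤s z≤n)       (s≤s z≤n)       a≢b = ⊥-elim (a≢b refl)
distinct-bits (s≤s z≤n)       (s≤s (s≤s z≤n)) _   = refl
distinct-bits (s≤s (s≤s z≤n)) (s≤s z≤n)       _   = refl
distinct-bits (s≤s (s≤s z≤n)) (s≤s (s≤s z≤n)) a≢b = ⊥-elim (a≢b refl)

module Equations {H : List ℕ} {m : ℕ} (φ : Elem H → Fin (ℕ.suc m)) where

  private
    V : Set
    V = Fin (ℕ.suc m)

  pointsEquation : ∀ {J} → (Fin J → G) → {Q : Pred V 0ℓ} → Decidable Q → Equation H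
  pointsEquation {J} h Q? = record
    { J = J ; E′ = λ e → does (Q? (φ e)) ; shift = h ; E = λ _ → isZero ∘ φ }

  invariantEquation : G → Equation H
  invariantEquation h = record
    { J = 2 ; E′ = const true ; shift = λ { zero → h ; (suc _) → 0G }
    ; E = λ { zero → isZero ∘ φ ; (suc _) → not ∘ isZero ∘ φ } }

  below? : ∀ J → Decidable (λ (y : V) → toℕ y < J)
  below? J y = toℕ y ℕ.<? J

  rangeEquation : ∀ {J} → (Fin J → G) → Equation H
  rangeEquation {J} h = pointsEquation h (below? J)

  pinEquation : Equation H
  pinEquation = rangeEquation pinShifts

  valueEquation : V → Equation H
  valueEquation c = pointsEquation {1} (const 0G) (FP._≟ c)

  module _ (φ-hom : Homomorphic₂ (Elem H) V _≡_ φ _⊕_ addFin) (α : G → Elem H) (x : G) where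

    ∈-coset⇔ : ∀ (S : V → Bool) e a → e ∈ a + (S ∘ φ) ⇔ S (subFin (φ e) (φ a)) ≡ true
    ∈-coset⇔ S e a = mk⇔
      (λ { (e₀ , Se₀ , refl) → subst (λ z → S z ≡ true) (sym (difference a e₀)) Se₀ })
      (λ Se → e ⊖ a , subst (λ z → S z ≡ true) (φ-⊖ e a) Se , sym (⊕-⊖ a e))
      where
      difference : ∀ a e₀ → subFin (φ (a ⊕ e₀)) (φ a) ≡ φ e₀
      difference a e₀ = trans (cong (λ z → subFin z (φ a)) (φ-hom a e₀)) (subFin-addFin (φ a) (φ e₀))
      φ-⊖ : ∀ e a → subFin (φ e) (φ a) ≡ φ (e ⊖ a)
      φ-⊖ e a = trans (cong (λ z → subFin (φ z) (φ a)) (sym (⊕-⊖ a e))) (difference a (e ⊖ a))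

    ∈-kernelCoset⇔ : ∀ e a → e ∈ a + (isZero ∘ φ) ⇔ φ e ≡ φ a
    ∈-kernelCoset⇔ e a = ⇔-trans (∈-coset⇔ isZero e a) (⇔-trans isZero⇔ subFin≡zero⇔)

    ∈-coKernelCoset⇔ : ∀ e a → e ∈ a + (not ∘ isZero ∘ φ) ⇔ φ e ≢ φ a
    ∈-coKernelCoset⇔ e a = ⇔-trans (∈-coset⇔ (not ∘ isZero) e a)
      (mk⇔ (λ p eq → Equivalence.to notZero⇔ p (Equivalence.from subFin≡zero⇔ eq))
           (λ ne → Equivalence.from notZero⇔ (ne ∘ Equivalence.to subFin≡zero⇔)))

    private
      ∈-self : ∀ h → α (x +G h) ∈ α (x +G h) + (isZero ∘ φ)
      ∈-self h = Equivalence.from (∈-kernelCoset⇔ _ _) refl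

    holds-points⇒ : ∀ {J} (h : Fin J → G) {Q} (Q? : Decidable Q) → Holds (pointsEquation h Q?) α x →
                    (∀ i j → φ (α (x +G h i)) ≡ φ (α (x +G h j)) → i ≡ j) × (∀ j → Q (φ (α (x +G h j))))
    holds-points⇒ h {Q} Q? (disjoint , union) = injective , inQ
      where
      injective : ∀ i j → φ (α (x +G h i)) ≡ φ (α (x +G h j)) → i ≡ j
      injective i j eq with i FP.≟ j
      ... | yes i≡j = i≡j
      ... | no  i≢j = ⊥-elim (disjoint i j i≢j _ (∈-self (h i)) (Equivalence.from (∈-kernelCoset⇔ _ _) eq))
      inQ : ∀ j → Q (φ (α (x +G h j)))
      inQ j = Equivalence.to (does⇔ (Q? _)) (proj₂ (union (α (x +G h j))) (j , ∈-self (h j)))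

    holds-points⇐ : ∀ {J} (h : Fin J → G) {Q} (Q? : Decidable Q) →
                    (∀ i j → φ (α (x +G h i)) ≡ φ (α (x +G h j)) → i ≡ j) → (∀ j → Q (φ (α (x +G h j)))) →
                    (∀ y → Q y → ∃ λ j → φ (α (x +G h j)) ≡ y) → Holds (pointsEquation h Q?) α x
    holds-points⇐ h {Q} Q? injective inQ onto = disjoint , λ e → covered e , inside e
      where
      toKernel : ∀ {e a} → e ∈ a + (isZero ∘ φ) → φ e ≡ φ a
      toKernel = Equivalence.to (∈-kernelCoset⇔ _ _)
      disjoint : ∀ i j → i ≢ j → ∀ e → e ∈ α (x +G h i) + (isZero ∘ φ) → e ∈ α (x +G h j) + (isZero ∘ φ) → ⊥
      disjoint i j i≢j e ei ej = i≢j (injective i j (trans (sym (toKernel ei)) (toKernel ej)))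
      covered : ∀ e → does (Q? (φ e)) ≡ true → ∃ λ j → e ∈ α (x +G h j) + (isZero ∘ φ)
      covered e Qe = let (j , vj≡φe) = onto (φ e) (Equivalence.to (does⇔ (Q? _)) Qe)
                     in j , Equivalence.from (∈-kernelCoset⇔ _ _) (sym vj≡φe)
      inside : ∀ e → (∃ λ j → e ∈ α (x +G h j) + (isZero ∘ φ)) → does (Q? (φ e)) ≡ true
      inside e (j , ej) = Equivalence.from (does⇔ (Q? _)) (subst Q (sym (toKernel ej)) (inQ j))

    holds-range⇒ : ∀ {J} (h : Fin J → G) → Holds (rangeEquation h) α x →
                   (∀ i j → φ (α (x +G h i)) ≡ φ (α (x +G h j)) → i ≡ j) × (∀ j → toℕ (φ (α (x +G h j))) < J)
    holds-range⇒ {J} h = holds-points⇒ h (below? J)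

    holds-range⇐ : ∀ {J} (h : Fin J → G) (ρ : Permutation′ J) →
                   (∀ j → toℕ (φ (α (x +G h j))) ≡ toℕ (ρ ⟨$⟩ʳ j)) → Holds (rangeEquation h) α x
    holds-range⇐ {J} h ρ v≡ρ = holds-points⇐ h (below? J) injective inRange onto
      where
      injective : ∀ i j → φ (α (x +G h i)) ≡ φ (α (x +G h j)) → i ≡ j
      injective i j eq = trans (sym (inverseˡ ρ)) (trans (cong (ρ ⟨$⟩ˡ_) ρi≡ρj) (inverseˡ ρ))
        where ρi≡ρj = FP.toℕ-injective (trans (sym (v≡ρ i)) (trans (cong toℕ eq) (v≡ρ j)))
      inRange : ∀ j → toℕ (φ (α (x +G h j))) < J
      inRange j = subst (_< J) (sym (v≡ρ j)) (FP.toℕ<n _)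
      onto : ∀ y → toℕ y < J → ∃ λ j → φ (α (x +G h j)) ≡ y
      onto y y<J = ρ ⟨$⟩ˡ fromℕ< y<J
                 , FP.toℕ-injective (trans (v≡ρ _) (trans (cong toℕ (inverseʳ ρ)) (FP.toℕ-fromℕ< y<J)))

    holds-pin⇔ : Holds pinEquation α x ⇔ toℕ (φ (α x)) ℕ.+ toℕ (φ (α (x +G flipLayer))) ≡ 1
    holds-pin⇔ = mk⇔ to from
      where
      at0 : ∀ {A : Set} (P : G → A) → P (x +G 0G) ≡ P x
      at0 P = cong P (+G-identityʳ x)
      to : Holds pinEquation α x → toℕ (φ (α x)) ℕ.+ toℕ (φ (α (x +G flipLayer))) ≡ 1
      to hold = subst (λ a → a ℕ.+ toℕ (φ (α (x +G flipLayer))) ≡ 1) (at0 (toℕ ∘ φ ∘ α))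
        (distinct-bits (below zero) (below (suc zero)) (λ eq → 0≢1 (injective zero (suc zero) (FP.toℕ-injective eq))))
        where
        injective = proj₁ (holds-range⇒ pinShifts hold)
        below = proj₂ (holds-range⇒ pinShifts hold)
        0≢1 : zero ≢ suc zero
        0≢1 ()
      from : toℕ (φ (α x)) ℕ.+ toℕ (φ (α (x +G flipLayer))) ≡ 1 → Holds pinEquation α x
      from sum with +≡1⇒ (subst (λ a → a ℕ.+ toℕ (φ (α (x +G flipLayer))) ≡ 1) (sym (at0 (toℕ ∘ φ ∘ α))) sum)
      ... | inj₁ (a≡0 , b≡1) = holds-range⇐ pinShifts Perm.id λ { zero → a≡0 ; (suc zero) → b≡1 ; (suc (suc ())) }
      ... | inj₂ (a≡1 , b≡0) = holds-range⇐ pinShifts Perm.reverse λ { zero → a≡1 ; (suc zero) → b≡0 ; (suc (suc ())) }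

    holds-value⇔ : ∀ c → Holds (valueEquation c) α x ⇔ φ (α x) ≡ c
    holds-value⇔ c = mk⇔
      (λ hold → subst (λ y → φ (α y) ≡ c) (+G-identityʳ x) (proj₂ (holds-points⇒ (const 0G) (FP._≟ c) hold) zero))
      (λ eq → let eq′ = subst (λ y → φ (α y) ≡ c) (sym (+G-identityʳ x)) eq in
        holds-points⇐ (const 0G) (FP._≟ c) (λ { zero zero _ → refl ; zero (suc ()) ; (suc ()) }) (λ { zero → eq′ ; (suc ()) })
          (λ y y≡c → zero , trans eq′ (sym y≡c)))

    holds-invariant⇔ : ∀ h → Holds (invariantEquation h) α x ⇔ φ (α (x +G h)) ≡ φ (α x)
    holds-invariant⇔ h = ⇔-trans (mk⇔ to from)
      (mk⇔ (λ eq → trans eq (cong (φ ∘ α) (+G-identityʳ x))) (λ eq → trans eq (cong (φ ∘ α) (sym (+G-identityʳ x)))))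
      where
      kernel = λ {e} {a} → ∈-kernelCoset⇔ e a
      coKernel = λ {e} {a} → ∈-coKernelCoset⇔ e a
      to : Holds (invariantEquation h) α x → φ (α (x +G h)) ≡ φ (α (x +G 0G))
      to (_ , union) with proj₁ (union (α (x +G 0G))) refl
      ... | zero     , e∈ = sym (Equivalence.to kernel e∈)
      ... | suc zero , e∈ = ⊥-elim (Equivalence.to coKernel e∈ refl)
      from : φ (α (x +G h)) ≡ φ (α (x +G 0G)) → Holds (invariantEquation h) α x
      from eq = disjoint , λ e → cover e , const refl
        where
        disjoint : ∀ j j′ → j ≢ j′ → ∀ e → _
        disjoint zero       zero       j≢j′ _ _  _  = j≢j′ refl
        disjoint zero       (suc zero) _    _ e₀ e₁ = Equivalence.to coKernel e₁ (trans (Equivalence.to kernel e₀) eq)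
        disjoint (suc zero) zero       _    _ e₁ e₀ = Equivalence.to coKernel e₁ (trans (Equivalence.to kernel e₀) eq)
        disjoint (suc zero) (suc zero) j≢j′ _ _  _  = j≢j′ refl
        cover : ∀ e → true ≡ true → _
        cover e _ with φ e FP.≟ φ (α (x +G h))
        ... | yes φe≡ = zero , Equivalence.from kernel φe≡
        ... | no  φe≢ = suc zero , Equivalence.from coKernel (λ φe≡ → φe≢ (trans φe≡ (sym eq)))

-- One-hot tables and linear forms

*-+-interchange : ∀ c y z A B → c ℕ.* (y ℕ.+ z) ℕ.+ (A ℕ.+ B) ≡ (c ℕ.* y ℕ.+ A) ℕ.+ (c ℕ.* z ℕ.+ B)
*-+-interchange = solve 5 (λ c y z A B → c :* (y :+ z) :+ (A :+ B) := (c :* y :+ A) :+ (c :* z :+ B)) refl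
  where open ℕSolver.+-*-Solver

-- Stated without subtraction on the left: it is the value of a form on the complemented layer
-- (see toℕ-form-encode), and the right side exhibits its residue K ∸ w.
offset-identity : ∀ K s T C w → C ℕ.+ w ≡ T → w ≤ K → (K ℕ.+ s ℕ.* T) ℕ.* 1 ℕ.+ C ≡ K ℕ.∸ w ℕ.+ T ℕ.* ℕ.suc s
offset-identity K s T C w C+w≡T w≤K = ℕP.+-cancelʳ-≡ w _ _ (begin
  (K ℕ.+ s ℕ.* T) ℕ.* 1 ℕ.+ C ℕ.+ w    ≡⟨ ℕP.+-assoc ((K ℕ.+ s ℕ.* T) ℕ.* 1) C w ⟩
  (K ℕ.+ s ℕ.* T) ℕ.* 1 ℕ.+ (C ℕ.+ w)  ≡⟨ cong ((K ℕ.+ s ℕ.* T) ℕ.* 1 ℕ.+_) C+w≡T ⟩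
  (K ℕ.+ s ℕ.* T) ℕ.* 1 ℕ.+ T          ≡⟨ solve 3 (λ K s T → (K :+ s :* T) :* con 1 :+ T := K :+ T :* (con 1 :+ s)) refl K s T ⟩
  K ℕ.+ T ℕ.* ℕ.suc s                  ≡⟨ cong (ℕ._+ T ℕ.* ℕ.suc s) (ℕP.m∸n+n≡m w≤K) ⟨
  K ℕ.∸ w ℕ.+ w ℕ.+ T ℕ.* ℕ.suc s      ≡⟨ solve 3 (λ a w b → a :+ w :+ b := a :+ b :+ w) refl (K ℕ.∸ w) w (T ℕ.* ℕ.suc s) ⟩
  K ℕ.∸ w ℕ.+ T ℕ.* ℕ.suc s ℕ.+ w      ∎)
  where
  open ≡-Reasoning
  open ℕSolver.+-*-Solver

module Tables (d : ℕ) where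

  M : ℕ
  M = ℕ.suc (ℕ.suc d)

  Table : ℕ → Set
  Table n = Elem (L.replicate n (ℕ.suc d))

  component : ∀ {n} → Table n → Fin n → Fin M
  component (y , _)  zero    = y
  component (_ , ys) (suc ℓ) = component ys ℓ

  constant : ∀ {n} → Fin M → Table n
  constant {ℕ.zero}  _ = tt
  constant {ℕ.suc n} y = y , constant y

  oneHot : ∀ {n} → Fin n → Table n
  oneHot zero    = suc zero , constant zero
  oneHot (suc ℓ) = zero , oneHot ℓ

  coHot : ∀ {n} → Fin n → Table n
  coHot zero    = zero , constant (suc zero)
  coHot (suc ℓ) = suc zero , coHot ℓ

  weigh : ∀ {n} → (Fin n → ℕ) → Table n → ℕ
  weigh {ℕ.zero}  _ _        = 0
  weigh {ℕ.suc n} w (y , ys) = w zero ℕ.* toℕ y ℕ.+ weigh (w ∘ suc) ys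

  component-hom : ∀ {n} (ℓ : Fin n) → Homomorphic₂ (Table n) (Fin M) _≡_ (λ t → component t ℓ) _⊕_ addFin
  component-hom zero    (_ , _)  (_ , _)  = refl
  component-hom (suc ℓ) (_ , ys) (_ , zs) = component-hom ℓ ys zs

  component-constant : ∀ {n} (y : Fin M) (ℓ : Fin n) → component (constant y) ℓ ≡ y
  component-constant y zero    = refl
  component-constant y (suc ℓ) = component-constant y ℓ

  oneHot-coHot-complementary : ∀ {n} (ℓ ℓ′ : Fin n) →
                               toℕ (component (oneHot ℓ) ℓ′) ℕ.+ toℕ (component (coHot ℓ) ℓ′) ≡ 1
  oneHot-coHot-complementary zero    zero     = refl
  oneHot-coHot-complementary zero    (suc ℓ′) =
    cong₂ (λ a b → toℕ a ℕ.+ toℕ b) (component-constant zero ℓ′) (component-constant (suc zero) ℓ′)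
  oneHot-coHot-complementary (suc ℓ) zero     = refl
  oneHot-coHot-complementary (suc ℓ) (suc ℓ′) = oneHot-coHot-complementary ℓ ℓ′

  weigh-zeros : ∀ {n} (w : Fin n → ℕ) → weigh w (constant zero) ≡ 0
  weigh-zeros {ℕ.zero}  w = refl
  weigh-zeros {ℕ.suc n} w = cong₂ ℕ._+_ (ℕP.*-zeroʳ (w zero)) (weigh-zeros (w ∘ suc))

  weigh-oneHot : ∀ {n} (w : Fin n → ℕ) ℓ → weigh w (oneHot ℓ) ≡ w ℓ
  weigh-oneHot w zero    = trans (cong₂ ℕ._+_ (ℕP.*-identityʳ (w zero)) (weigh-zeros (w ∘ suc))) (ℕP.+-identityʳ (w zero))
  weigh-oneHot w (suc ℓ) = cong₂ ℕ._+_ (ℕP.*-zeroʳ (w zero)) (weigh-oneHot (w ∘ suc) ℓ)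

  weigh-coHot : ∀ {n} (w : Fin n → ℕ) ℓ → weigh w (coHot ℓ) ℕ.+ w ℓ ≡ weigh w (constant (suc zero))
  weigh-coHot w zero = begin
    w zero ℕ.* 0 ℕ.+ weigh (w ∘ suc) (constant (suc zero)) ℕ.+ w zero
      ≡⟨ cong (λ a → a ℕ.+ weigh (w ∘ suc) (constant (suc zero)) ℕ.+ w zero) (ℕP.*-zeroʳ (w zero)) ⟩
    weigh (w ∘ suc) (constant (suc zero)) ℕ.+ w zero
      ≡⟨ ℕP.+-comm _ (w zero) ⟩
    w zero ℕ.+ weigh (w ∘ suc) (constant (suc zero))
      ≡⟨ cong (ℕ._+ weigh (w ∘ suc) (constant (suc zero))) (ℕP.*-identityʳ (w zero)) ⟨
    w zero ℕ.* 1 ℕ.+ weigh (w ∘ suc) (constant (suc zero))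
      ∎
    where open ≡-Reasoning
  weigh-coHot w (suc ℓ) =
    trans (ℕP.+-assoc (w zero ℕ.* 1) _ (w (suc ℓ))) (cong (w zero ℕ.* 1 ℕ.+_) (weigh-coHot (w ∘ suc) ℓ))

  weigh-%-hom : ∀ {n} (w : Fin n → ℕ) a b → weigh w (a ⊕ b) % M ≡ (weigh w a ℕ.+ weigh w b) % M
  weigh-%-hom {ℕ.zero}  w _        _        = refl
  weigh-%-hom {ℕ.suc n} w (y , ys) (z , zs) = trans
    (%-cong-+ (w zero ℕ.* toℕ (addFin y z)) (w zero ℕ.* (toℕ y ℕ.+ toℕ z))
              (weigh (w ∘ suc) (ys ⊕ zs)) (weigh (w ∘ suc) ys ℕ.+ weigh (w ∘ suc) zs)
      (%-cong-*ˡ (w zero) (toℕ (addFin y z)) (toℕ y ℕ.+ toℕ z) (toℕ-addFin-% y z))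
      (weigh-%-hom (w ∘ suc) ys zs))
    (cong (_% M) (*-+-interchange (w zero) (toℕ y) (toℕ z) (weigh (w ∘ suc) ys) (weigh (w ∘ suc) zs)))

  weigh-units-≤ : ∀ {n} (t : Table n) → (∀ ℓ → toℕ (component t ℓ) ≤ 1) → weigh (const 1) t ≤ n
  weigh-units-≤ {ℕ.zero}  _        _    = z≤n
  weigh-units-≤ {ℕ.suc n} (y , ys) bits =
    ℕP.+-mono-≤ (subst (_≤ 1) (sym (ℕP.*-identityˡ (toℕ y))) (bits zero)) (weigh-units-≤ ys (bits ∘ suc))

  weigh-units≡0 : ∀ {n} (t : Table n) → weigh (const 1) t ≡ 0 → t ≡ constant zero
  weigh-units≡0 {ℕ.zero}  _            _  = refl
  weigh-units≡0 {ℕ.suc n} (zero , ys)  w≡0 = cong (zero ,_) (weigh-units≡0 ys w≡0)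
  weigh-units≡0 {ℕ.suc n} (suc _ , _)  ()

  weigh-units≡1 : ∀ {n} (t : Table n) → (∀ ℓ → toℕ (component t ℓ) ≤ 1) →
                  weigh (const 1) t ≡ 1 → ∃ λ ℓ → t ≡ oneHot ℓ
  weigh-units≡1 {ℕ.suc n} (zero , ys) bits w≡1 =
    let (ℓ , ys≡) = weigh-units≡1 ys (bits ∘ suc) w≡1 in suc ℓ , cong (zero ,_) ys≡
  weigh-units≡1 {ℕ.suc n} (suc zero , ys) _ w≡1 =
    zero , cong (suc zero ,_) (weigh-units≡0 ys (ℕP.suc-injective w≡1))
  weigh-units≡1 {ℕ.suc n} (suc (suc _) , _) bits _ with bits zero
  ... | s≤s ()

  Point : ℕ → Set
  Point n = Table (ℕ.suc n)

  encode : ∀ {n} → Fin 2 → Fin n → Point n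
  encode zero    ℓ = zero , oneHot ℓ
  encode (suc _) ℓ = suc zero , coHot ℓ

  mirror : ∀ {k} → Fin 2 → Permutation′ k
  mirror zero    = Perm.id
  mirror (suc _) = Perm.reverse

  -- The coefficient of the mark is chosen so that the form reads K ∸ w ℓ on encode (suc zero) ℓ.
  offset : ∀ {K n} → (Fin n → Fin (ℕ.suc K)) → ℕ
  offset {K} w = K ℕ.+ ℕ.suc d ℕ.* weigh (toℕ ∘ w) (constant (suc zero))

  form : ∀ {K n} → (Fin n → Fin (ℕ.suc K)) → Point n → Fin M
  form w (τ , t) = (offset w ℕ.* toℕ τ ℕ.+ weigh (toℕ ∘ w) t) mod M

  form-hom : ∀ {K n} (w : Fin n → Fin (ℕ.suc K)) → Homomorphic₂ (Point n) (Fin M) _≡_ (form w) _⊕_ addFin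
  form-hom w (τ , t) (τ′ , t′) = mod-cong (c ℕ.* toℕ (addFin τ τ′) ℕ.+ W (t ⊕ t′))
                                          (toℕ (form w (τ , t)) ℕ.+ toℕ (form w (τ′ , t′))) (begin
    (c ℕ.* toℕ (addFin τ τ′) ℕ.+ W (t ⊕ t′)) % M
      ≡⟨ %-cong-+ (c ℕ.* toℕ (addFin τ τ′)) (c ℕ.* (toℕ τ ℕ.+ toℕ τ′)) (W (t ⊕ t′)) (W t ℕ.+ W t′)
           (%-cong-*ˡ c (toℕ (addFin τ τ′)) (toℕ τ ℕ.+ toℕ τ′) (toℕ-addFin-% τ τ′)) (weigh-%-hom (toℕ ∘ w) t t′) ⟩
    (c ℕ.* (toℕ τ ℕ.+ toℕ τ′) ℕ.+ (W t ℕ.+ W t′)) % M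
      ≡⟨ cong (_% M) (*-+-interchange c (toℕ τ) (toℕ τ′) (W t) (W t′)) ⟩
    (c ℕ.* toℕ τ ℕ.+ W t ℕ.+ (c ℕ.* toℕ τ′ ℕ.+ W t′)) % M
      ≡⟨ %-distribˡ-+ (c ℕ.* toℕ τ ℕ.+ W t) (c ℕ.* toℕ τ′ ℕ.+ W t′) M ⟩
    ((c ℕ.* toℕ τ ℕ.+ W t) % M ℕ.+ (c ℕ.* toℕ τ′ ℕ.+ W t′) % M) % M
      ≡⟨ cong₂ (λ a b → (a ℕ.+ b) % M) (toℕ-mod (c ℕ.* toℕ τ ℕ.+ W t)) (toℕ-mod (c ℕ.* toℕ τ′ ℕ.+ W t′)) ⟨
    (toℕ (form w (τ , t)) ℕ.+ toℕ (form w (τ′ , t′))) % M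
      ∎)
    where
    open ≡-Reasoning
    c = offset w
    W = weigh (toℕ ∘ w)

  form-layer₀ : ∀ {K n} (w : Fin n → Fin (ℕ.suc K)) t → form w (zero , t) ≡ weigh (toℕ ∘ w) t mod M
  form-layer₀ w t = cong (λ a → (a ℕ.+ weigh (toℕ ∘ w) t) mod M) (ℕP.*-zeroʳ (offset w))

  toℕ-form-encode : ∀ {K n} (w : Fin n → Fin (ℕ.suc K)) → K < M →
                    ∀ s ℓ → toℕ (form w (encode s ℓ)) ≡ toℕ (mirror s ⟨$⟩ʳ w ℓ)
  toℕ-form-encode w K<M zero ℓ = begin
    toℕ (form w (zero , oneHot ℓ))                ≡⟨ cong toℕ (form-layer₀ w (oneHot ℓ)) ⟩
    toℕ (weigh (toℕ ∘ w) (oneHot ℓ) mod M)        ≡⟨ toℕ-mod (weigh (toℕ ∘ w) (oneHot ℓ)) ⟩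
    weigh (toℕ ∘ w) (oneHot ℓ) % M                ≡⟨ cong (_% M) (weigh-oneHot (toℕ ∘ w) ℓ) ⟩
    toℕ (w ℓ) % M                                 ≡⟨ m<n⇒m%n≡m (ℕP.<-≤-trans (FP.toℕ<n (w ℓ)) K<M) ⟩
    toℕ (w ℓ)                                     ∎
    where open ≡-Reasoning
  toℕ-form-encode {K} w K<M (suc zero) ℓ = begin
    toℕ (form w (suc zero , coHot ℓ))                  ≡⟨ toℕ-mod (offset w ℕ.* 1 ℕ.+ weigh (toℕ ∘ w) (coHot ℓ)) ⟩
    (offset w ℕ.* 1 ℕ.+ weigh (toℕ ∘ w) (coHot ℓ)) % M  ≡⟨ cong (_% M) (offset-identity K (ℕ.suc d) _ _ (toℕ (w ℓ))
                                                            (weigh-coHot (toℕ ∘ w) ℓ) (ℕP.≤-pred (FP.toℕ<n (w ℓ)))) ⟩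
    (K ℕ.∸ toℕ (w ℓ) ℕ.+ T ℕ.* M) % M                  ≡⟨ [m+kn]%n≡m%n (K ℕ.∸ toℕ (w ℓ)) T M ⟩
    (K ℕ.∸ toℕ (w ℓ)) % M                              ≡⟨ m<n⇒m%n≡m (ℕP.≤-<-trans (ℕP.m∸n≤m K (toℕ (w ℓ))) K<M) ⟩
    K ℕ.∸ toℕ (w ℓ)                                    ≡⟨ FP.opposite-prop (w ℓ) ⟨
    toℕ (opposite (w ℓ))                               ∎
    where
    open ≡-Reasoning
    T = weigh (toℕ ∘ w) (constant (suc zero))

  form-encode-cong : ∀ {K n} (w : Fin n → Fin (ℕ.suc K)) → K < M →
                     ∀ c {ℓ ℓ′} → w ℓ ≡ w ℓ′ → form w (encode c ℓ) ≡ form w (encode c ℓ′)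
  form-encode-cong w K<M c {ℓ} {ℓ′} wℓ≡ = FP.toℕ-injective (begin
    toℕ (form w (encode c ℓ))     ≡⟨ toℕ-form-encode w K<M c ℓ ⟩
    toℕ (mirror c ⟨$⟩ʳ w ℓ)       ≡⟨ cong (λ y → toℕ (mirror c ⟨$⟩ʳ y)) wℓ≡ ⟩
    toℕ (mirror c ⟨$⟩ʳ w ℓ′)      ≡⟨ toℕ-form-encode w K<M c ℓ′ ⟨
    toℕ (form w (encode c ℓ′))    ∎)
    where open ≡-Reasoning

-- Enumerations, permutations and integer residues

vectors : ∀ {A : Set} → List A → (n : ℕ) → List (Vec A n)
vectors xs ℕ.zero    = V.[] ∷ []
vectors xs (ℕ.suc n) = L.cartesianProductWith V._∷_ xs (vectors xs n)

∈-vectors : ∀ {A : Set} {xs : List A} → (∀ a → a ∈ₗ xs) → ∀ {n} (v : Vec A n) → v ∈ₗ vectors xs n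
∈-vectors complete V.[]       = here refl
∈-vectors complete (a V.∷ v) = ∈-cartesianProductWith⁺ V._∷_ (complete a) (∈-vectors complete v)

injective⇒surjective : ∀ {n} (f : Fin n → Fin n) → (∀ {a b} → f a ≡ f b → a ≡ b) → ∀ y → ∃ λ x → f x ≡ y
injective⇒surjective {ℕ.suc n} f injective y with FP.any? (λ x → f x FP.≟ y)
... | yes hit = hit
... | no miss = ⊥-elim (ℕP.<-irrefl refl (FP.injective⇒≤ {f = squeeze} squeeze-injective))
  where
  squeeze : Fin (ℕ.suc n) → Fin n
  squeeze x = F.punchOut {i = y} (λ y≡fx → miss (x , sym y≡fx))
  squeeze-injective : ∀ {a b} → squeeze a ≡ squeeze b → a ≡ b
  squeeze-injective {a} {b} eq =
    injective (FP.punchOut-injective {i = y} (λ y≡fa → miss (a , sym y≡fa)) (λ y≡fb → miss (b , sym y≡fb)) eq)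

injective⇒permutation : ∀ {n} (f : Fin n → Fin n) → (∀ {a b} → f a ≡ f b → a ≡ b) →
                        Σ (Permutation′ n) λ σ → ∀ i → σ ⟨$⟩ʳ i ≡ f i
injective⇒permutation f injective =
  Perm.permutation f (proj₁ ∘ onto) (proj₂ ∘ onto) (λ x → injective (proj₂ (onto (f x)))) , λ _ → refl
  where onto = injective⇒surjective f injective

module _ {q : ℕ} .{{_ : ℕ.NonZero q}} where
  open ℤSolver.+-*-Solver

  private
    no-larger-residue : ∀ r r′ n → r′ < q → + r′ ≢ + r ℤ.+ + ℕ.suc n ℤ.* + q
    no-larger-residue r r′ n r′<q eq = ℕP.<-irrefl refl (ℕP.<-≤-trans r′<q (begin
      q                     ≤⟨ ℕP.m≤m+n q (n ℕ.* q) ⟩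
      ℕ.suc n ℕ.* q         ≤⟨ ℕP.m≤n+m (ℕ.suc n ℕ.* q) r ⟩
      r ℕ.+ ℕ.suc n ℕ.* q   ≡⟨ ℤP.+-injective eq′ ⟨
      r′                    ∎))
      where
      open ℕP.≤-Reasoning
      eq′ = trans eq (trans (cong (λ a → + r ℤ.+ a) (sym (ℤP.pos-* (ℕ.suc n) q))) (sym (ℤP.pos-+ r (ℕ.suc n ℕ.* q))))

  residue-unique : ∀ {r r′} (w : ℤ) → r < q → r′ < q → + r′ ≡ + r ℤ.+ w ℤ.* + q → r′ ≡ r
  residue-unique {r} {r′} (+ ℕ.zero) _ _ eq = ℤP.+-injective (trans eq (ℤP.+-identityʳ (+ r)))
  residue-unique {r} {r′} (+ ℕ.suc n) _ r′<q eq = ⊥-elim (no-larger-residue r r′ n r′<q eq)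
  residue-unique {r} {r′} -[1+ n ] r<q _ eq = ⊥-elim (no-larger-residue r′ r n r<q (begin
    + r                                      ≡⟨ solve 3 (λ R W Q → R := (R :+ W :* Q) :+ (:- W) :* Q) refl (+ r) -[1+ n ] (+ q) ⟩
    (+ r ℤ.+ -[1+ n ] ℤ.* + q) ℤ.+ + ℕ.suc n ℤ.* + q  ≡⟨ cong (ℤ._+ + ℕ.suc n ℤ.* + q) eq ⟨
    + r′ ℤ.+ + ℕ.suc n ℤ.* + q               ∎))
    where open ≡-Reasoning

  %ℕ-unique : ∀ x r z → r < q → x ≡ + r ℤ.+ z ℤ.* + q → x ℤ.%ℕ q ≡ r
  %ℕ-unique x r z r<q x≡ = residue-unique (z ℤ.- x ℤ./ℕ q) r<q (n%ℕd<d x q) (begin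
    + (x ℤ.%ℕ q)                                    ≡⟨ solve 3 (λ R Z Q → R := (R :+ Z :* Q) :- Z :* Q) refl (+ (x ℤ.%ℕ q)) (x ℤ./ℕ q) (+ q) ⟩
    (+ (x ℤ.%ℕ q) ℤ.+ x ℤ./ℕ q ℤ.* + q) ℤ.- x ℤ./ℕ q ℤ.* + q ≡⟨ cong (ℤ._- x ℤ./ℕ q ℤ.* + q) (a≡a%ℕn+[a/ℕn]*n x q) ⟨
    x ℤ.- x ℤ./ℕ q ℤ.* + q                          ≡⟨ cong (ℤ._- x ℤ./ℕ q ℤ.* + q) x≡ ⟩
    (+ r ℤ.+ z ℤ.* + q) ℤ.- x ℤ./ℕ q ℤ.* + q        ≡⟨ solve 4 (λ R Z Z′ Q → (R :+ Z :* Q) :- Z′ :* Q := R :+ (Z :- Z′) :* Q) refl (+ r) z (x ℤ./ℕ q) (+ q) ⟩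
    + r ℤ.+ (z ℤ.- x ℤ./ℕ q) ℤ.* + q                ∎)
    where open ≡-Reasoning

reduce-+ : ∀ q′ m n → reduce q′ (m ℤ.+ + n) ≡ addFin (reduce q′ m) (n mod ℕ.suc q′)
reduce-+ q′ m n = FP.toℕ-injective (begin
  toℕ (reduce q′ (m ℤ.+ + n))              ≡⟨ FP.toℕ-fromℕ< _ ⟩
  (m ℤ.+ + n) ℤ.%ℕ q                       ≡⟨ %ℕ-unique (m ℤ.+ + n) ((r ℕ.+ n) % q) (m ℤ./ℕ q ℤ.+ + ((r ℕ.+ n) / q))
                                                (m%n<n (r ℕ.+ n) q) decomposition ⟩
  (r ℕ.+ n) % q                            ≡⟨ %-absorbʳ r n ⟨
  (r ℕ.+ n % q) % q                        ≡⟨ cong (λ a → (a ℕ.+ n % q) % q) (FP.toℕ-fromℕ< (n%ℕd<d m q)) ⟨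
  (toℕ (reduce q′ m) ℕ.+ n % q) % q        ≡⟨ cong (λ a → (toℕ (reduce q′ m) ℕ.+ a) % q) (toℕ-mod n) ⟨
  (toℕ (reduce q′ m) ℕ.+ toℕ (n mod q)) % q ≡⟨ toℕ-mod (toℕ (reduce q′ m) ℕ.+ toℕ (n mod q)) ⟨
  toℕ (addFin (reduce q′ m) (n mod q))     ∎)
  where
  open ≡-Reasoning
  open ℤSolver.+-*-Solver
  q = ℕ.suc q′
  r = m ℤ.%ℕ q
  decomposition : m ℤ.+ + n ≡ + ((r ℕ.+ n) % q) ℤ.+ (m ℤ./ℕ q ℤ.+ + ((r ℕ.+ n) / q)) ℤ.* + q
  decomposition = begin
    m ℤ.+ + n                                              ≡⟨ cong (ℤ._+ + n) (a≡a%ℕn+[a/ℕn]*n m q) ⟩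
    + r ℤ.+ m ℤ./ℕ q ℤ.* + q ℤ.+ + n                       ≡⟨ solve 4 (λ R Z Q N → R :+ Z :* Q :+ N := (R :+ N) :+ Z :* Q) refl (+ r) (m ℤ./ℕ q) (+ q) (+ n) ⟩
    + (r ℕ.+ n) ℤ.+ m ℤ./ℕ q ℤ.* + q                       ≡⟨ cong (λ a → + a ℤ.+ m ℤ./ℕ q ℤ.* + q) (m≡m%n+[m/n]*n (r ℕ.+ n) q) ⟩
    + ((r ℕ.+ n) % q ℕ.+ (r ℕ.+ n) / q ℕ.* q) ℤ.+ m ℤ./ℕ q ℤ.* + q
      ≡⟨ cong (ℤ._+ m ℤ./ℕ q ℤ.* + q) (trans (ℤP.pos-+ ((r ℕ.+ n) % q) ((r ℕ.+ n) / q ℕ.* q)) (cong (λ a → + ((r ℕ.+ n) % q) ℤ.+ a) (ℤP.pos-* ((r ℕ.+ n) / q) q))) ⟩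
    + ((r ℕ.+ n) % q) ℤ.+ + ((r ℕ.+ n) / q) ℤ.* + q ℤ.+ m ℤ./ℕ q ℤ.* + q
      ≡⟨ solve 4 (λ R A Z Q → R :+ A :* Q :+ Z :* Q := R :+ (Z :+ A) :* Q) refl (+ ((r ℕ.+ n) % q)) (+ ((r ℕ.+ n) / q)) (m ℤ./ℕ q) (+ q) ⟩
    + ((r ℕ.+ n) % q) ℤ.+ (m ℤ./ℕ q ℤ.+ + ((r ℕ.+ n) / q)) ℤ.* + q ∎

reduce-periodic : ∀ q′ m → reduce q′ (m ℤ.+ + ℕ.suc q′) ≡ reduce q′ m
reduce-periodic q′ m = trans (reduce-+ q′ m (ℕ.suc q′))
  (trans (cong (addFin (reduce q′ m)) (FP.toℕ-injective (trans (toℕ-mod (ℕ.suc q′)) (n%n≡0 (ℕ.suc q′)))))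
         (addFin-identityʳ (reduce q′ m)))

-- The system attached to a Sudoku instance

module Construction (I : SudokuInstance) where
  open SudokuInstance I

  q : ℕ
  q = ℕ.suc q′

  Cell : Set
  Cell = Fin q × Fin (ℕ.suc k)

  Pattern : Set
  Pattern = Vec Cell N

  Allowed : Pattern → Set
  Allowed π = rule (V.map proj₂ π) ≡ true × VAll (λ c → cond (proj₁ c) (proj₂ c) ≡ true) π

  allowed? : Decidable Allowed
  allowed? π = (rule (V.map proj₂ π) Bool.≟ true) ×-dec VAll.all? (λ c → cond (proj₁ c) (proj₂ c) Bool.≟ true) π

  candidates : List Pattern
  candidates = vectors (L.cartesianProduct (L.allFin q) (L.allFin (ℕ.suc k))) N

  patterns : List Pattern
  patterns = L.filter allowed? candidates

  nP : ℕ
  nP = length patterns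

  allowedPattern : Fin nP → Pattern
  allowedPattern = L.lookup patterns

  allowedPattern-allowed : ∀ ℓ → Allowed (allowedPattern ℓ)
  allowedPattern-allowed ℓ = proj₂ (∈-filter⁻ allowed? {xs = candidates} (∈-lookup ℓ))

  allowed⇒indexed : ∀ π → Allowed π → ∃ λ ℓ → allowedPattern ℓ ≡ π
  allowed⇒indexed π ok = Any.index π∈ , sym (lookup-index π∈)
    where
    π∈ = ∈-filter⁺ allowed? (∈-vectors (λ (c , s) → ∈-cartesianProduct⁺ (∈-allFin c) (∈-allFin s)) π) ok

  symbolAt : Fin N → Fin nP → Fin (ℕ.suc k)
  symbolAt n ℓ = proj₂ (V.lookup (allowedPattern ℓ) n)

  cellAt : Fin N → Fin nP → Fin q
  cellAt n ℓ = proj₁ (V.lookup (allowedPattern ℓ) n)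

  -- K = 2, so that the count of a one-hot table and of its complement both read 1.
  count : Fin nP → Fin 3
  count _ = suc zero

  -- The modulus 2 + d exceeds nP, k, q′ and 2, so that no reading wraps around.
  d : ℕ
  d = ℕ.suc (nP ℕ.+ k ℕ.+ q′)

  open Tables d

  private
    below-modulus : ∀ {a} → a ≤ nP ℕ.+ k ℕ.+ q′ → a < M
    below-modulus a≤ = s≤s (ℕP.m≤n⇒m≤1+n (ℕP.m≤n⇒m≤1+n a≤))

  nP<M : nP < M
  nP<M = below-modulus (ℕP.≤-trans (ℕP.m≤m+n nP k) (ℕP.m≤m+n (nP ℕ.+ k) q′))

  k<M : k < M
  k<M = below-modulus (ℕP.≤-trans (ℕP.m≤n+m k nP) (ℕP.m≤m+n (nP ℕ.+ k) q′))

  q′<M : q′ < M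
  q′<M = below-modulus (ℕP.m≤n+m q′ (nP ℕ.+ k))

  2<M : 2 < M
  2<M = s≤s (s≤s (s≤s z≤n))

  mark : Point nP → Fin M
  mark = proj₁

  bit : Fin nP → Point nP → Fin M
  bit ℓ p = component (proj₂ p) ℓ

  mark-hom : Homomorphic₂ (Point nP) (Fin M) _≡_ mark _⊕_ addFin
  mark-hom _ _ = refl

  bit-hom : ∀ ℓ → Homomorphic₂ (Point nP) (Fin M) _≡_ (bit ℓ) _⊕_ addFin
  bit-hom ℓ (_ , t) (_ , t′) = component-hom ℓ t t′

  open Equations using (pinEquation; invariantEquation; valueEquation; rangeEquation)

  markPin markStep₁ markStep₂ countOne : Equation (L.replicate (ℕ.suc nP) (ℕ.suc d))
  markPin   = pinEquation mark
  markStep₁ = invariantEquation mark (step ℤ.1ℤ ℤ.0ℤ)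
  markStep₂ = invariantEquation mark (step ℤ.0ℤ ℤ.1ℤ)
  countOne  = valueEquation (form count) (suc zero)

  bitPin : Fin nP → Equation (L.replicate (ℕ.suc nP) (ℕ.suc d))
  bitPin ℓ = pinEquation (bit ℓ)

  windowShift : Fin q → G
  windowShift r = step ℤ.0ℤ (+ toℕ r)

  symbolDiagonal cellPeriodic cellWindow : Fin N → Equation (L.replicate (ℕ.suc nP) (ℕ.suc d))
  symbolDiagonal n = invariantEquation (form (symbolAt n)) (step ℤ.1ℤ (ℤ.- + toℕ n))
  cellPeriodic   n = invariantEquation (form (cellAt n)) (step ℤ.0ℤ (+ q))
  cellWindow     n = rangeEquation (form (cellAt n)) windowShift

  system : System (L.replicate (ℕ.suc nP) (ℕ.suc d))
  system = markPin ∷ markStep₁ ∷ markStep₂ ∷ countOne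
         ∷ L.tabulate bitPin ++ L.tabulate symbolDiagonal ++ L.tabulate cellPeriodic ++ L.tabulate cellWindow

  weakSystem : WeakSystem
  weakSystem = record { H₁ = [] ; H₂ = L.replicate (ℕ.suc nP) (ℕ.suc d) ; sys = system }

  record Solves (β : G → Point nP) : Set where
    field
      mark-pin        : ∀ x → Holds markPin β x
      mark-step₁      : ∀ x → Holds markStep₁ β x
      mark-step₂      : ∀ x → Holds markStep₂ β x
      count-one       : ∀ x → Holds countOne β x
      bit-pin         : ∀ ℓ x → Holds (bitPin ℓ) β x
      symbol-diagonal : ∀ n x → Holds (symbolDiagonal n) β x
      cell-periodic   : ∀ n x → Holds (cellPeriodic n) β x
      cell-window     : ∀ n x → Holds (cellWindow n) β x

  satisfies⇔solves : ∀ β → SatisfiesSystem system β ⇔ Solves β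
  satisfies⇔solves β = mk⇔ to from
    where
    to : SatisfiesSystem system β → Solves β
    to (p₁ ∷ p₂ ∷ p₃ ∷ p₄ ∷ rest) =
      let (bits , rest₁)     = AllP.++⁻ (L.tabulate bitPin) rest
          (symbols , rest₂)  = AllP.++⁻ (L.tabulate symbolDiagonal) rest₁
          (periods , windows) = AllP.++⁻ (L.tabulate cellPeriodic) rest₂
      in record
        { mark-pin = p₁ ; mark-step₁ = p₂ ; mark-step₂ = p₃ ; count-one = p₄
        ; bit-pin = AllP.tabulate⁻ bits ; symbol-diagonal = AllP.tabulate⁻ symbols
        ; cell-periodic = AllP.tabulate⁻ periods ; cell-window = AllP.tabulate⁻ windows }
    from : Solves β → SatisfiesSystem system β
    from S = mark-pin ∷ mark-step₁ ∷ mark-step₂ ∷ count-one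
           ∷ AllP.++⁺ (AllP.tabulate⁺ bit-pin) (AllP.++⁺ (AllP.tabulate⁺ symbol-diagonal)
               (AllP.++⁺ (AllP.tabulate⁺ cell-periodic) (AllP.tabulate⁺ cell-window)))
      where open Solves S

  module Decode (β : G → Point nP) (solves : Solves β) where
    open Solves solves

    invariant : ∀ {φ : Point nP → Fin M} → Homomorphic₂ (Point nP) (Fin M) _≡_ φ _⊕_ addFin →
                ∀ {h} → (∀ x → Holds (invariantEquation φ h) β x) → ∀ x → φ (β (x +G h)) ≡ φ (β x)
    invariant {φ} φ-hom {h} hold x = Equivalence.to (Equations.holds-invariant⇔ φ φ-hom β x h) (hold x)

    marks-complementary : ∀ x → toℕ (mark (β x)) ℕ.+ toℕ (mark (β (x +G flipLayer))) ≡ 1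
    marks-complementary x = Equivalence.to (Equations.holds-pin⇔ mark mark-hom β x) (mark-pin x)

    bits-complementary : ∀ ℓ x → toℕ (bit ℓ (β x)) ℕ.+ toℕ (bit ℓ (β (x +G flipLayer))) ≡ 1
    bits-complementary ℓ x = Equivalence.to (Equations.holds-pin⇔ (bit ℓ) (bit-hom ℓ) β x) (bit-pin ℓ x)

    baseLayer : Σ (Fin 2) λ c → mark (β (+ 0 , + 0 , c)) ≡ zero
    baseLayer with +≡1⇒ (marks-complementary (+ 0 , + 0 , zero))
    ... | inj₁ (a≡0 , _) = zero , FP.toℕ-injective a≡0
    ... | inj₂ (_ , b≡0) = suc zero , FP.toℕ-injective (trans (cong (toℕ ∘ mark ∘ β) (sym (+G-flipLayer _ _ zero))) b≡0)

    c₀ : Fin 2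
    c₀ = proj₁ baseLayer

    mark-base : ∀ j i → mark (β (j , i , c₀)) ≡ zero
    mark-base j i = trans (invariant-plane (mark ∘ β) (invariant mark-hom mark-step₁) (invariant mark-hom mark-step₂) j i c₀)
                          (proj₂ baseLayer)

    -- With the mark 0 the count form is the plain number of set bits, which is below the modulus.
    decode : ∀ j i → ∃ λ ℓ → β (j , i , c₀) ≡ encode zero ℓ
    decode j i = let (ℓ , t≡) = weigh-units≡1 t bits count≡1 in ℓ , cong₂ _,_ (mark-base j i) t≡
      where
      t = proj₂ (β (j , i , c₀))
      bits : ∀ ℓ → toℕ (component t ℓ) ≤ 1
      bits ℓ = subst (toℕ (component t ℓ) ≤_) (bits-complementary ℓ (j , i , c₀))
                     (ℕP.m≤m+n (toℕ (component t ℓ)) (toℕ (bit ℓ (β ((j , i , c₀) +G flipLayer)))))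
      form-count≡1 : form count (zero , t) ≡ suc zero
      form-count≡1 = trans (cong (λ τ → form count (τ , t)) (sym (mark-base j i)))
                           (Equivalence.to (Equations.holds-value⇔ (form count) (form-hom count) β (j , i , c₀) (suc zero)) (count-one (j , i , c₀)))
      count≡1 : weigh (const 1) t ≡ 1
      count≡1 = begin
        weigh (const 1) t              ≡⟨ m<n⇒m%n≡m (ℕP.≤-<-trans (weigh-units-≤ t bits) nP<M) ⟨
        weigh (const 1) t % M          ≡⟨ toℕ-mod (weigh (const 1) t) ⟨
        toℕ (weigh (const 1) t mod M)  ≡⟨ cong toℕ (form-layer₀ count t) ⟨
        toℕ (form count (zero , t))    ≡⟨ cong toℕ form-count≡1 ⟩
        1                              ∎
        where open ≡-Reasoning

    index : ℤ → ℤ → Fin nP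
    index j i = proj₁ (decode j i)

    read : ∀ {K} (w : Fin nP → Fin (ℕ.suc K)) → K < M →
           ∀ j i → toℕ (form w (β (j , i , c₀))) ≡ toℕ (w (index j i))
    read w K<M j i = trans (cong (toℕ ∘ form w) (proj₂ (decode j i))) (toℕ-form-encode w K<M zero (index j i))

    read-injective : ∀ {K} (w : Fin nP → Fin (ℕ.suc K)) → K < M → ∀ {j i j′ i′} →
                     form w (β (j , i , c₀)) ≡ form w (β (j′ , i′ , c₀)) → w (index j i) ≡ w (index j′ i′)
    read-injective w K<M {j} {i} {j′} {i′} eq =
      FP.toℕ-injective (trans (sym (read w K<M j i)) (trans (cong toℕ eq) (read w K<M j′ i′)))

    symbol-along-diagonal : ∀ n j i → symbolAt n (index j i) ≡ symbolAt n (index (+ 0) (j ℤ.* + toℕ n ℤ.+ i))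
    symbol-along-diagonal n j i = read-injective (symbolAt n) k<M
      (invariant-diagonal (form (symbolAt n) ∘ β) (+ toℕ n) (invariant (form-hom (symbolAt n)) (symbol-diagonal n)) j i c₀)

    cell-periodic-in-column : ∀ n m → cellAt n (index (+ 0) m) ≡ cellAt n (index (+ 0) (+ (m ℤ.%ℕ q)))
    cell-periodic-in-column n m = read-injective (cellAt n) q′<M
      (invariant-period (form (cellAt n) ∘ β) q (invariant (form-hom (cellAt n)) (cell-periodic n)) m c₀)

    cell-window-injective : ∀ n {r r′ : Fin q} →
                            cellAt n (index (+ 0) (+ toℕ r)) ≡ cellAt n (index (+ 0) (+ toℕ r′)) → r ≡ r′
    cell-window-injective n {r} {r′} eq = proj₁ window-facts r r′ (begin
      form (cellAt n) (β (origin +G step ℤ.0ℤ (+ toℕ r)))  ≡⟨ cong (form (cellAt n) ∘ β) (+G-step (+ 0) (+ 0) c₀ ℤ.0ℤ (+ toℕ r)) ⟩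
      form (cellAt n) (β (+ 0 , + toℕ r , c₀))           ≡⟨ FP.toℕ-injective read-equal ⟩
      form (cellAt n) (β (+ 0 , + toℕ r′ , c₀))          ≡⟨ cong (form (cellAt n) ∘ β) (+G-step (+ 0) (+ 0) c₀ ℤ.0ℤ (+ toℕ r′)) ⟨
      form (cellAt n) (β (origin +G step ℤ.0ℤ (+ toℕ r′))) ∎)
      where
      open ≡-Reasoning
      origin = (+ 0 , + 0 , c₀)
      window-facts = Equations.holds-range⇒ (form (cellAt n)) (form-hom (cellAt n)) β origin windowShift (cell-window n origin)
      read-equal = trans (read (cellAt n) q′<M (+ 0) (+ toℕ r)) (trans (cong toℕ eq) (sym (read (cellAt n) q′<M (+ 0) (+ toℕ r′))))

    F : Fin N → ℤ → Fin (ℕ.suc k)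
    F n m = symbolAt n (index (+ 0) m)

    isSolution : IsSudokuSolution I F
    isSolution j i = begin
      rule (V.tabulate (λ n → F n (j ℤ.* + toℕ n ℤ.+ i)))         ≡⟨ cong rule (VP.tabulate-cong (λ n → symbol-along-diagonal n j i)) ⟨
      rule (V.tabulate (λ n → symbolAt n (index j i)))            ≡⟨ cong rule (VP.tabulate-∘ proj₂ (V.lookup π)) ⟩
      rule (V.map proj₂ (V.tabulate (V.lookup π)))                ≡⟨ cong (rule ∘ V.map proj₂) (VP.tabulate∘lookup π) ⟩
      rule (V.map proj₂ π)                                        ≡⟨ proj₁ (allowedPattern-allowed (index j i)) ⟩
      true                                                        ∎
      where
      open ≡-Reasoning
      π = allowedPattern (index j i)

    obeys : Obeys I F
    obeys n = σ , λ m → subst (λ c → cond c (F n m) ≡ true) (sym (σ-reduce m))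
                                (VAllP.lookup⁺ (proj₂ (allowedPattern-allowed (index (+ 0) m))) n)
      where
      window : Fin q → Fin q
      window r = cellAt n (index (+ 0) (+ toℕ r))
      σ,σ≡window = injective⇒permutation window (cell-window-injective n)
      σ = proj₁ σ,σ≡window
      σ-reduce : ∀ m → σ ⟨$⟩ʳ reduce q′ m ≡ cellAt n (index (+ 0) m)
      σ-reduce m = trans (proj₂ σ,σ≡window (reduce q′ m))
        (trans (cong (λ r → cellAt n (index (+ 0) (+ r))) (FP.toℕ-fromℕ< (n%ℕd<d m q))) (sym (cell-periodic-in-column n m)))

    solvable : Solvable I
    solvable = F , isSolution , obeys

  module Encode (F : Fin N → ℤ → Fin (ℕ.suc k)) (isSolution : IsSudokuSolution I F) (obeys : Obeys I F) where
    open ℤSolver.+-*-Solver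

    σ : Fin N → Permutation′ q
    σ n = proj₁ (obeys n)

    position : Fin N → ℤ → ℤ → ℤ
    position n j i = j ℤ.* + toℕ n ℤ.+ i

    position-diagonal : ∀ n j i → position n (j ℤ.+ ℤ.1ℤ) (i ℤ.+ ℤ.- + toℕ n) ≡ position n j i
    position-diagonal n j i =
      solve 3 (λ j a i → (j :+ con ℤ.1ℤ) :* a :+ (i :+ :- a) := j :* a :+ i) refl j (+ toℕ n) i

    position-shift : ∀ n j i p → position n (j ℤ.+ ℤ.0ℤ) (i ℤ.+ p) ≡ position n j i ℤ.+ p
    position-shift n j i p =
      solve 4 (λ j a i p → (j :+ con ℤ.0ℤ) :* a :+ (i :+ p) := (j :* a :+ i) :+ p) refl j (+ toℕ n) i p

    patternAt : ℤ → ℤ → Pattern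
    patternAt j i = V.tabulate λ n → σ n ⟨$⟩ʳ reduce q′ (position n j i) , F n (position n j i)

    patternAt-allowed : ∀ j i → Allowed (patternAt j i)
    patternAt-allowed j i =
        trans (cong rule (sym (VP.tabulate-∘ proj₂ _))) (isSolution j i)
      , VAllP.lookup⁻ λ n → subst (λ c → cond (proj₁ c) (proj₂ c) ≡ true) (sym (VP.lookup∘tabulate _ n))
                                  (proj₂ (obeys n) (position n j i))

    index : ℤ → ℤ → Fin nP
    index j i = proj₁ (allowed⇒indexed (patternAt j i) (patternAt-allowed j i))

    entry-index : ∀ n j i → V.lookup (allowedPattern (index j i)) n ≡ (σ n ⟨$⟩ʳ reduce q′ (position n j i) , F n (position n j i))
    entry-index n j i = trans (cong (λ π → V.lookup π n) (proj₂ (allowed⇒indexed (patternAt j i) (patternAt-allowed j i))))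
                              (VP.lookup∘tabulate _ n)

    β : G → Point nP
    β (j , i , c) = encode c (index j i)

    at-flip : ∀ j i c → β ((j , i , c) +G flipLayer) ≡ encode (opposite c) (index j i)
    at-flip j i c = cong β (+G-flipLayer j i c)

    at-step : ∀ j i c a b → β ((j , i , c) +G step a b) ≡ encode c (index (j ℤ.+ a) (i ℤ.+ b))
    at-step j i c a b = cong β (+G-step j i c a b)

    mark-pin : ∀ x → Holds markPin β x
    mark-pin (j , i , c) = Equivalence.from (Equations.holds-pin⇔ mark mark-hom β (j , i , c))
      (trans (cong (λ p → toℕ (mark (β (j , i , c))) ℕ.+ toℕ (mark p)) (at-flip j i c)) (marks c))
      where
      marks : ∀ c → toℕ (mark (encode {nP} c (index j i))) ℕ.+ toℕ (mark (encode (opposite c) (index j i))) ≡ 1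
      marks zero       = refl
      marks (suc zero) = refl

    bit-pin : ∀ ℓ x → Holds (bitPin ℓ) β x
    bit-pin ℓ (j , i , c) = Equivalence.from (Equations.holds-pin⇔ (bit ℓ) (bit-hom ℓ) β (j , i , c))
      (trans (cong (λ p → toℕ (bit ℓ (β (j , i , c))) ℕ.+ toℕ (bit ℓ p)) (at-flip j i c)) (bits c))
      where
      bits : ∀ c → toℕ (bit ℓ (encode c (index j i))) ℕ.+ toℕ (bit ℓ (encode (opposite c) (index j i))) ≡ 1
      bits zero       = oneHot-coHot-complementary (index j i) ℓ
      bits (suc zero) = trans (ℕP.+-comm (toℕ (component (coHot (index j i)) ℓ)) (toℕ (component (oneHot (index j i)) ℓ)))
                              (oneHot-coHot-complementary (index j i) ℓ)

    mark-invariant : ∀ a b x → Holds (invariantEquation mark (step a b)) β x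
    mark-invariant a b (j , i , c) = Equivalence.from (Equations.holds-invariant⇔ mark mark-hom β (j , i , c) (step a b))
      (trans (cong mark (at-step j i c a b)) (marks c))
      where
      marks : ∀ c → mark (encode {nP} c (index (j ℤ.+ a) (i ℤ.+ b))) ≡ mark (encode c (index j i))
      marks zero       = refl
      marks (suc zero) = refl

    count-one : ∀ x → Holds countOne β x
    count-one (j , i , c) = Equivalence.from (Equations.holds-value⇔ (form count) (form-hom count) β (j , i , c) (suc zero))
      (FP.toℕ-injective (trans (toℕ-form-encode count 2<M c (index j i)) (mirrored-one c)))
      where
      mirrored-one : ∀ c → toℕ (mirror c ⟨$⟩ʳ suc {2} zero) ≡ 1
      mirrored-one zero       = refl
      mirrored-one (suc zero) = refl

    form-invariant : ∀ {K} (w : Fin nP → Fin (ℕ.suc K)) → K < M → ∀ a b →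
                     (∀ j i → w (index (j ℤ.+ a) (i ℤ.+ b)) ≡ w (index j i)) →
                     ∀ x → Holds (invariantEquation (form w) (step a b)) β x
    form-invariant w K<M a b w-invariant (j , i , c) =
      Equivalence.from (Equations.holds-invariant⇔ (form w) (form-hom w) β (j , i , c) (step a b))
        (trans (cong (form w) (at-step j i c a b)) (form-encode-cong w K<M c (w-invariant j i)))

    symbol-diagonal : ∀ n x → Holds (symbolDiagonal n) β x
    symbol-diagonal n = form-invariant (symbolAt n) k<M ℤ.1ℤ (ℤ.- + toℕ n) λ j i →
      trans (cong proj₂ (entry-index n (j ℤ.+ ℤ.1ℤ) (i ℤ.+ ℤ.- + toℕ n)))
            (trans (cong (F n) (position-diagonal n j i)) (sym (cong proj₂ (entry-index n j i))))

    cell-periodic : ∀ n x → Holds (cellPeriodic n) β x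
    cell-periodic n = form-invariant (cellAt n) q′<M ℤ.0ℤ (+ q) λ j i →
      trans (cong proj₁ (entry-index n (j ℤ.+ ℤ.0ℤ) (i ℤ.+ + q)))
            (trans (cong (λ m → σ n ⟨$⟩ʳ reduce q′ m) (position-shift n j i (+ q)))
            (trans (cong (σ n ⟨$⟩ʳ_) (reduce-periodic q′ (position n j i)))
                   (sym (cong proj₁ (entry-index n j i)))))

    cell-window : ∀ n x → Holds (cellWindow n) β x
    cell-window n (j , i , c) = Equations.holds-range⇐ (form (cellAt n)) (form-hom (cellAt n)) β (j , i , c) windowShift
      (rotation (reduce q′ (position n j i)) Perm.∘ₚ σ n Perm.∘ₚ mirror c) λ r → begin
        toℕ (form (cellAt n) (β ((j , i , c) +G windowShift r)))
          ≡⟨ cong (toℕ ∘ form (cellAt n)) (at-step j i c ℤ.0ℤ (+ toℕ r)) ⟩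
        toℕ (form (cellAt n) (encode c (index (j ℤ.+ ℤ.0ℤ) (i ℤ.+ + toℕ r))))
          ≡⟨ toℕ-form-encode (cellAt n) q′<M c _ ⟩
        toℕ (mirror c ⟨$⟩ʳ cellAt n (index (j ℤ.+ ℤ.0ℤ) (i ℤ.+ + toℕ r)))
          ≡⟨ cong (λ y → toℕ (mirror c ⟨$⟩ʳ y)) cell≡ ⟩
        toℕ (mirror c ⟨$⟩ʳ (σ n ⟨$⟩ʳ addFin (reduce q′ (position n j i)) r))
          ∎
      where
      open ≡-Reasoning
      cell≡ : ∀ {r} → cellAt n (index (j ℤ.+ ℤ.0ℤ) (i ℤ.+ + toℕ r)) ≡ σ n ⟨$⟩ʳ addFin (reduce q′ (position n j i)) r
      cell≡ {r} = trans (cong proj₁ (entry-index n (j ℤ.+ ℤ.0ℤ) (i ℤ.+ + toℕ r)))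
        (cong (σ n ⟨$⟩ʳ_) (trans (cong (reduce q′) (position-shift n j i (+ toℕ r)))
          (trans (reduce-+ q′ (position n j i) (toℕ r)) (cong (addFin (reduce q′ (position n j i))) (toℕ-mod-toℕ r)))))

    solves : Solves β
    solves = record
      { mark-pin = mark-pin ; mark-step₁ = mark-invariant ℤ.1ℤ ℤ.0ℤ ; mark-step₂ = mark-invariant ℤ.0ℤ ℤ.1ℤ
      ; count-one = count-one ; bit-pin = bit-pin ; symbol-diagonal = symbol-diagonal
      ; cell-periodic = cell-periodic ; cell-window = cell-window }

    satisfiable : Satisfiable weakSystem
    satisfiable = const tt , β , Equivalence.from (satisfies⇔solves β) solves

theorem6p4 : Σ (SudokuInstance → WeakSystem) (λ alg → (I : SudokuInstance) → Solvable I ⇔ Satisfiable (alg I))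
theorem6p4 = Construction.weakSystem , λ I → mk⇔
  (λ (F , isSolution , obeys) → Construction.Encode.satisfiable I F isSolution obeys)
  (λ (_ , β , satisfies) → Construction.Decode.solvable I β (Equivalence.to (Construction.satisfies⇔solves I β) satisfies))
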